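{- Let $T$ be a tree of stars and let $\mathcal{C}(T)$ be its set of centers. Then $V(T)\setminus \mathcal{C}(T)$ is the unique maximum stable set of $T$.
   Context: A leaf of a tree is a vertex of degree at most $1$. Trees of stars are defined inductively: a single vertex is a tree of stars; if $T_1,\dots,T_k$ ($k\ge2$) are disjoint trees of stars and $v_i$ is a leaf of $T_i$, then the tree obtained from $T_1\cup\dots\cup T_k$ by adding a new vertex $w$ adjacent to all $v_i$ is a tree of stars. In a tree of stars, for any vertex $v$ the distances from $v$ to all leaves have the same parity; $v$ is a center if these distances are odd. -}

module Defs where

open import Data.Nat using (ℕ; zero; suc; _≤_; _+_)
open import Data.Fin using (Fin)
open import Data.Fin.Properties using () renaming (_≟_ to _≟ᶠ_)
open import Data.Unit using (⊤; tt)
open import Data.Empty using (⊥)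
open import Data.Sum using (_⊎_; inj₁; inj₂)
open import Data.Product using (Σ; _×_; _,_; ∃)
open import Data.Bool using (Bool; true; false; if_then_else_)
open import Data.List using (List; []; _∷_; map; concatMap)
open import Data.Nat.ListAction using (sum)
open import Data.List using () renaming (allFin to allFinL)
open import Relation.Nullary using (¬_; yes; no)
open import Relation.Binary.PropositionalEquality using (_≡_; refl)
open import Function.Bundles using (_⇔_)

-- Raw rooted data for the inductive construction of trees of stars.
-- 'join k ts ls' : disjoint union of the trees ts i (i < k) plus a new
-- vertex w adjacent to the chosen vertices ls i.  The side conditions
-- (k ≥ 2, each ls i a leaf, each ts i a tree of stars) are in 'IsTreeOfStars'.
mutual
  data TS : Set where
    single : TS
    join   : (k : ℕ) (ts : Fin k → TS) (ls : (i : Fin k) → Vert (ts i)) → TS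

  Vert : TS → Set
  Vert single           = ⊤
  Vert (join k ts ls)   = ⊤ ⊎ Σ (Fin k) (λ i → Vert (ts i))

Adj : (T : TS) → Vert T → Vert T → Set
Adj single _ _ = ⊥
Adj (join k ts ls) (inj₁ _) (inj₁ _) = ⊥
Adj (join k ts ls) (inj₁ _) (inj₂ (i , v)) = v ≡ ls i
Adj (join k ts ls) (inj₂ (i , v)) (inj₁ _) = v ≡ ls i
Adj (join k ts ls) (inj₂ (i , u)) (inj₂ (j , v)) with i ≟ᶠ j
... | yes refl = Adj (ts i) u v
... | no _ = ⊥

allV : (T : TS) → List (Vert T)
allV single = tt ∷ []
allV (join k ts ls) =
  inj₁ tt ∷ concatMap (λ i → map (λ v → inj₂ (i , v)) (allV (ts i))) (allFinL k)

IsLeaf : (T : TS) → Vert T → Set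
IsLeaf T v = ∀ u u' → Adj T v u → Adj T v u' → u ≡ u'

IsTreeOfStars : TS → Set
IsTreeOfStars single = ⊤
IsTreeOfStars (join k ts ls) =
  (2 ≤ k) × ((i : Fin k) → IsTreeOfStars (ts i)) × ((i : Fin k) → IsLeaf (ts i) (ls i))

data Walk (T : TS) : Vert T → Vert T → ℕ → Set where
  nil  : ∀ {v} → Walk T v v zero
  cons : ∀ {u w v n} → Adj T u w → Walk T w v n → Walk T u v (suc n)

Dist : (T : TS) → Vert T → Vert T → ℕ → Set
Dist T u v d = Walk T u v d × (∀ d' → Walk T u v d' → d ≤ d')

data Odd : ℕ → Set where
  odd-one : Odd 1
  odd-ss  : ∀ {n} → Odd n → Odd (suc (suc n))

IsCenter : (T : TS) → Vert T → Set
IsCenter T v = ∀ ℓ → IsLeaf T ℓ → ∀ d → Dist T v ℓ d → Odd d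

Subset : TS → Set
Subset T = Vert T → Bool

card : (T : TS) → Subset T → ℕ
card T S = sum (map (λ v → if S v then 1 else 0) (allV T))

IsStable : (T : TS) → Subset T → Set
IsStable T S = ∀ u v → S u ≡ true → S v ≡ true → ¬ Adj T u v

IsMaximumStable : (T : TS) → Subset T → Set
IsMaximumStable T S = IsStable T S × (∀ S' → IsStable T S' → card T S' ≤ card T S)

IsNonCenterSet : (T : TS) → Subset T → Set
IsNonCenterSet T S = ∀ v → (S v ≡ true) ⇔ (¬ IsCenter T v)

-- Colour the vertices of a tree of stars T recursively: a single vertex is
-- coloured true, the new vertex w of a join is coloured false, and the
-- components keep their colours.  Every leaf is coloured true and adjacent
-- vertices get different colours, so the colour of v is the parity of its
-- distance to any leaf: the true vertices are exactly V(T) ∖ C(T), and they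
-- form a stable set.  It is the unique maximum one, by induction: a stable S
-- avoiding w is at most as large on every component; a stable S containing w
-- avoids every attachment leaf, which is coloured true, so S loses at least
-- one vertex on each of the k ≥ 2 components and gains only w.
module Submission where

open import Defs
open import Algebra.Properties.CommutativeSemigroup using (x∙yz≈y∙xz)
open import Data.Bool using (Bool; true; false; not; _xor_; if_then_else_)
open import Data.Bool.Properties
  using (not-involutive; not-injective; not-distribʳ-xor; xor-identityʳ; ¬-not)
  renaming (_≟_ to _≟ᵇ_)
open import Data.Empty using (⊥-elim)
open import Data.Fin using (Fin; zero; suc)
open import Data.Fin.Properties using () renaming (_≟_ to _≟ᶠ_)
open import Data.List using (List; []; _∷_; _++_; map; concatMap; length; allFin)
open import Data.List.Membership.Propositional using (_∈_)
open import Data.List.Membership.Propositional.Properties using (∈-allFin)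
open import Data.List.Properties using (map-cong; map-∘; map-++; length-tabulate)
open import Data.List.Relation.Unary.Any using (here; there)
open import Data.Nat using (ℕ; zero; suc; _+_; _≤_; _<_; _≤?_; z≤n; s≤s)
open import Data.Nat.Induction using (<-rec)
open import Data.Nat.ListAction using (sum)
open import Data.Nat.ListAction.Properties using (sum-++)
open import Data.Nat.Properties using (≤-refl; ≤-trans; ≤-reflexive; <⇒≤; <⇒≱; ≰⇒>;
  +-mono-≤; +-mono-≤-<; +-monoˡ-≤; +-commutativeSemigroup; module ≤-Reasoning)
open import Data.Product using (∃; _×_; _,_; proj₁; proj₂)
open import Data.Sum using (_⊎_; inj₁; inj₂)
open import Data.Unit using (tt)
open import Function.Base using (id; case_of_)
open import Function.Bundles using (mk⇔)
open import Relation.Nullary using (¬_; yes; no)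
open import Relation.Binary.PropositionalEquality

private
  variable
    A B : Set
    m n : ℕ

parity : ℕ → Bool
parity zero    = false
parity (suc n) = not (parity n)

odd⇒parity : Odd n → parity n ≡ true
odd⇒parity odd-one             = refl
odd⇒parity (odd-ss {n} odd-n) rewrite not-involutive (parity n) = odd⇒parity odd-n

parity⇒odd : ∀ n → parity n ≡ true → Odd n
parity⇒odd (suc zero)    _ = odd-one
parity⇒odd (suc (suc n)) e rewrite not-involutive (parity n) = odd-ss (parity⇒odd n e)

-- Constructively a shortest walk exists only under double negation, which
-- suffices to refute that a vertex is a center.
¬¬-least : ∀ {P : ℕ → Set} → P n → ¬ ¬ (∃ λ d → P d × (∀ d′ → P d′ → d ≤ d′))
¬¬-least {n} {P} = <-rec (λ n → P n → ¬ ¬ Least) step n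
  where
  Least = ∃ λ d → P d × (∀ d′ → P d′ → d ≤ d′)
  step : ∀ n → (∀ {m} → m < n → P m → ¬ ¬ Least) → P n → ¬ ¬ Least
  step n below pn ¬least = ¬least (n , pn , minimal)
    where
    minimal : ∀ d′ → P d′ → n ≤ d′
    minimal d′ pd′ with n ≤? d′
    ... | yes n≤d′ = n≤d′
    ... | no  n≰d′ = ⊥-elim (below (≰⇒> n≰d′) pd′ ¬least)

sum-map-concatMap : ∀ (f : B → ℕ) (g : A → List B) xs →
  sum (map f (concatMap g xs)) ≡ sum (map (λ x → sum (map f (g x))) xs)
sum-map-concatMap f g []       = refl
sum-map-concatMap f g (x ∷ xs) = begin
  sum (map f (g x ++ concatMap g xs))                ≡⟨ cong sum (map-++ f (g x) _) ⟩
  sum (map f (g x) ++ map f (concatMap g xs))        ≡⟨ sum-++ (map f (g x)) _ ⟩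
  sum (map f (g x)) + sum (map f (concatMap g xs))   ≡⟨ cong (_ +_) (sum-map-concatMap f g xs) ⟩
  sum (map f (g x)) + sum (map (λ x → sum (map f (g x))) xs) ∎
  where open ≡-Reasoning

module _ {f g : A → ℕ} where

  sum-map-mono : (∀ x → f x ≤ g x) → ∀ xs → sum (map f xs) ≤ sum (map g xs)
  sum-map-mono f≤g []       = z≤n
  sum-map-mono f≤g (x ∷ xs) = +-mono-≤ (f≤g x) (sum-map-mono f≤g xs)

  sum-map-mono-< : (∀ x → f x ≤ g x) → ∀ {y xs} → y ∈ xs → f y < g y →
                   sum (map f xs) < sum (map g xs)
  sum-map-mono-< f≤g {xs = _ ∷ xs} (here refl) fy<gy = +-mono-≤ fy<gy (sum-map-mono f≤g xs)
  sum-map-mono-< f≤g {xs = x ∷ _}  (there y∈xs) fy<gy = +-mono-≤-< (f≤g x) (sum-map-mono-< f≤g y∈xs fy<gy)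

  length+sum-map-≤ : (∀ x → f x < g x) → ∀ xs → length xs + sum (map f xs) ≤ sum (map g xs)
  length+sum-map-≤ f<g []       = z≤n
  length+sum-map-≤ f<g (x ∷ xs) = ≤-trans
    (≤-reflexive (cong suc (x∙yz≈y∙xz +-commutativeSemigroup (length xs) (f x) _)))
    (+-mono-≤ (f<g x) (length+sum-map-≤ f<g xs))

Isolated : (T : TS) → Vert T → Set
Isolated T v = ∀ u → ¬ Adj T v u

module _ {k : ℕ} {ts : Fin k → TS} {ls : (i : Fin k) → Vert (ts i)} where

  adj-lift : ∀ i {u v} → Adj (ts i) u v → Adj (join k ts ls) (inj₂ (i , u)) (inj₂ (i , v))
  adj-lift i a with i ≟ᶠ i
  ... | yes refl = a
  ... | no  i≢i  = ⊥-elim (i≢i refl)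

  walk-lift : ∀ i {u v} → Walk (ts i) u v n → Walk (join k ts ls) (inj₂ (i , u)) (inj₂ (i , v)) n
  walk-lift i nil        = nil
  walk-lift i (cons a w) = cons (adj-lift i a) (walk-lift i w)

  inner-neighbour : ∀ {i u} x → Adj (join k ts ls) (inj₂ (i , u)) x →
    (x ≡ inj₁ tt × u ≡ ls i) ⊎ ∃ λ u′ → x ≡ inj₂ (i , u′) × Adj (ts i) u u′
  inner-neighbour       (inj₁ tt)      a = inj₁ (refl , a)
  inner-neighbour {i} (inj₂ (j , v)) a with i ≟ᶠ j
  ... | yes refl = inj₂ (v , refl , a)
  ... | no  _    = ⊥-elim a

  leaf-restrict : ∀ i {v} → IsLeaf (join k ts ls) (inj₂ (i , v)) → IsLeaf (ts i) v
  leaf-restrict i leaf u u′ a a′ with leaf _ _ (adj-lift i a) (adj-lift i a′)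
  ... | refl = refl

  leaf-lift : ∀ j {ℓ} → IsLeaf (ts j) ℓ → (ℓ ≡ ls j → Isolated (ts j) ℓ) →
              IsLeaf (join k ts ls) (inj₂ (j , ℓ))
  leaf-lift j leaf isolated x x′ a a′ with inner-neighbour x a | inner-neighbour x′ a′
  ... | inj₁ (refl , _)     | inj₁ (refl , _)       = refl
  ... | inj₁ (_ , ℓ≡l)      | inj₂ (_ , _ , b)      = ⊥-elim (isolated ℓ≡l _ b)
  ... | inj₂ (_ , _ , b)    | inj₁ (_ , ℓ≡l)        = ⊥-elim (isolated ℓ≡l _ b)
  ... | inj₂ (u , refl , b) | inj₂ (u′ , refl , b′) = cong (λ v → inj₂ (j , v)) (leaf u u′ b b′)

_++ʷ_ : ∀ {T u v w} → Walk T u v m → Walk T v w n → Walk T u w (m + n)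
nil      ++ʷ w′ = w′
cons a w ++ʷ w′ = cons a (w ++ʷ w′)

connected : ∀ T u v → ∃ (Walk T u v)
connected single         tt tt = _ , nil
connected (join k ts ls) u  v  = _ , proj₂ (toRoot u) ++ʷ proj₂ (fromRoot v)
  where
  toRoot : ∀ x → ∃ (Walk (join k ts ls) x (inj₁ tt))
  toRoot (inj₁ tt)      = _ , nil
  toRoot (inj₂ (i , x)) = _ , walk-lift i (proj₂ (connected (ts i) x (ls i))) ++ʷ cons refl nil
  fromRoot : ∀ x → ∃ (Walk (join k ts ls) (inj₁ tt) x)
  fromRoot (inj₁ tt)      = _ , nil
  fromRoot (inj₂ (i , x)) = _ , cons refl (walk-lift i (proj₂ (connected (ts i) (ls i) x)))

-- The isolation clause is what leaf-lift needs when x is the attachment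
-- vertex; it covers the single-vertex tree, whose only leaf cannot avoid x.
leaf-avoiding : ∀ T → IsTreeOfStars T → ∀ x → ∃ λ ℓ → IsLeaf T ℓ × (ℓ ≡ x → Isolated T ℓ)
leaf-avoiding single _ tt = tt , (λ _ _ ()) , (λ _ _ ())
leaf-avoiding (join (suc (suc k)) ts ls) (s≤s (s≤s z≤n) , trees , _) = avoid
  where
  T = join (suc (suc k)) ts ls
  leafIn : ∀ j → ∃ λ ℓ → IsLeaf T (inj₂ (j , ℓ))
  leafIn j with leaf-avoiding (ts j) (trees j) (ls j)
  ... | ℓ , leaf , isolated = ℓ , leaf-lift j leaf isolated
  avoid : ∀ x → ∃ λ ℓ → IsLeaf T ℓ × (ℓ ≡ x → Isolated T ℓ)
  avoid (inj₁ tt)          = inj₂ (zero , proj₁ (leafIn zero)) , proj₂ (leafIn zero) , λ ()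
  avoid (inj₂ (zero , _))  = inj₂ (suc zero , proj₁ (leafIn (suc zero))) , proj₂ (leafIn (suc zero)) , λ ()
  avoid (inj₂ (suc _ , _)) = inj₂ (zero , proj₁ (leafIn zero)) , proj₂ (leafIn zero) , λ ()

nonCenters : (T : TS) → Subset T
nonCenters single         _              = true
nonCenters (join k ts ls) (inj₁ _)       = false
nonCenters (join k ts ls) (inj₂ (i , v)) = nonCenters (ts i) v

leaf-nonCenters : ∀ T → IsTreeOfStars T → ∀ {ℓ} → IsLeaf T ℓ → nonCenters T ℓ ≡ true
leaf-nonCenters single _ _ = refl
leaf-nonCenters (join _ ts ls) (s≤s (s≤s z≤n) , _) {inj₁ tt} leaf
  with leaf (inj₂ (zero , ls zero)) (inj₂ (suc zero , ls (suc zero))) refl refl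
... | ()
leaf-nonCenters (join k ts ls) (_ , trees , _) {inj₂ (i , v)} leaf =
  leaf-nonCenters (ts i) (trees i) (leaf-restrict i leaf)

nonCenters-adj : ∀ T → IsTreeOfStars T → ∀ {u v} → Adj T u v → nonCenters T u ≡ not (nonCenters T v)
nonCenters-adj (join k ts ls) (_ , trees , leaves) {inj₁ _} {inj₂ (i , v)} refl
  rewrite leaf-nonCenters (ts i) (trees i) (leaves i) = refl
nonCenters-adj (join k ts ls) (_ , trees , leaves) {inj₂ (i , u)} {inj₁ _} refl
  rewrite leaf-nonCenters (ts i) (trees i) (leaves i) = refl
nonCenters-adj (join k ts ls) (_ , trees , _) {inj₂ (i , u)} {inj₂ (j , v)} a with i ≟ᶠ j
... | yes refl = nonCenters-adj (ts i) (trees i) a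
... | no  _    = ⊥-elim a

nonCenters-stable : ∀ T → IsTreeOfStars T → IsStable T (nonCenters T)
nonCenters-stable T H u v u∈ v∈ a with trans (sym u∈) (trans (nonCenters-adj T H a) (cong not v∈))
... | ()

walk-parity : ∀ T → IsTreeOfStars T → ∀ {u v} → Walk T u v n →
              nonCenters T u ≡ nonCenters T v xor parity n
walk-parity T H nil = sym (xor-identityʳ _)
walk-parity T H (cons {w = w} {v} {n} a walk) = begin
  nonCenters T _                            ≡⟨ nonCenters-adj T H a ⟩
  not (nonCenters T w)                      ≡⟨ cong not (walk-parity T H walk) ⟩
  not (nonCenters T v xor parity n)         ≡⟨ not-distribʳ-xor (nonCenters T v) (parity n) ⟩
  nonCenters T v xor parity (suc n)         ∎
  where open ≡-Reasoning

leaf-walk-parity : ∀ T → IsTreeOfStars T → ∀ {n v ℓ} → IsLeaf T ℓ → Walk T v ℓ n →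
                   nonCenters T v ≡ not (parity n)
leaf-walk-parity T H {n = n} leaf walk =
  trans (walk-parity T H walk) (cong (_xor parity n) (leaf-nonCenters T H leaf))

nonCenters≡false⇒center : ∀ T → IsTreeOfStars T → ∀ {v} → nonCenters T v ≡ false → IsCenter T v
nonCenters≡false⇒center T H v∉ ℓ leaf d (walk , _) =
  parity⇒odd d (not-injective (trans (sym (leaf-walk-parity T H leaf walk)) v∉))

nonCenters≡true⇒¬center : ∀ T → IsTreeOfStars T → ∀ {v} → nonCenters T v ≡ true → ¬ IsCenter T v
nonCenters≡true⇒¬center T H {v} v∈ center with leaf-avoiding T H v
... | ℓ , leaf , _ = ¬¬-least (proj₂ (connected T v ℓ)) λ (d , walk , shortest) →
  case trans (sym v∈) (trans (leaf-walk-parity T H leaf walk)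
                             (cong not (odd⇒parity (center ℓ leaf d (walk , shortest))))) of λ ()

nonCenters-correct : ∀ T → IsTreeOfStars T → IsNonCenterSet T (nonCenters T)
nonCenters-correct T H v = mk⇔ (nonCenters≡true⇒¬center T H) (¬center⇒true (nonCenters T v) refl)
  where
  ¬center⇒true : ∀ b → nonCenters T v ≡ b → ¬ IsCenter T v → b ≡ true
  ¬center⇒true true  _  _       = refl
  ¬center⇒true false v∉ ¬center = ⊥-elim (¬center (nonCenters≡false⇒center T H v∉))

card-join : ∀ k ts ls (S : Subset (join k ts ls)) {b} → S (inj₁ tt) ≡ b →
  card (join k ts ls) S ≡
  (if b then 1 else 0) + sum (map (λ i → card (ts i) (λ v → S (inj₂ (i , v)))) (allFin k))
card-join k ts ls S refl = cong ((if S (inj₁ tt) then 1 else 0) +_) (begin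
  sum (map indicator (concatMap (λ i → map (λ v → inj₂ (i , v)) (allV (ts i))) (allFin k)))
    ≡⟨ sum-map-concatMap indicator _ (allFin k) ⟩
  sum (map (λ i → sum (map indicator (map (λ v → inj₂ (i , v)) (allV (ts i))))) (allFin k))
    ≡⟨ cong sum (map-cong (λ i → cong sum (map-∘ (allV (ts i))) ) (allFin k)) ⟨
  sum (map (λ i → card (ts i) (λ v → S (inj₂ (i , v)))) (allFin k)) ∎)
  where
  open ≡-Reasoning
  indicator : Vert (join k ts ls) → ℕ
  indicator v = if S v then 1 else 0

restrict-stable : ∀ {k ts ls} {S : Subset (join k ts ls)} → IsStable (join k ts ls) S →
                  ∀ i → IsStable (ts i) (λ v → S (inj₂ (i , v)))
restrict-stable {ls = ls} stable i u v u∈ v∈ a = stable _ _ u∈ v∈ (adj-lift {ls = ls} i a)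

mutual
  stable-card-≤ : ∀ T → IsTreeOfStars T → ∀ S → IsStable T S → card T S ≤ card T (nonCenters T)
  stable-card-≤ single _ S _ with S tt
  ... | true  = ≤-refl
  ... | false = z≤n
  stable-card-≤ (join k ts ls) H@(_ , trees , _) S stable with S (inj₁ tt) ≟ᵇ true
  ... | yes w∈ = <⇒≤ (root∈-card-< H S stable w∈)
  ... | no  w∉ = begin
    card (join k ts ls) S                                         ≡⟨ card-join k ts ls S (¬-not w∉) ⟩
    sum (map (λ i → card (ts i) (λ v → S (inj₂ (i , v)))) (allFin k))
      ≤⟨ sum-map-mono (λ i → stable-card-≤ (ts i) (trees i) _ (restrict-stable stable i)) (allFin k) ⟩
    sum (map (λ i → card (ts i) (nonCenters (ts i))) (allFin k))  ≡⟨ card-join k ts ls (nonCenters _) refl ⟨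
    card (join k ts ls) (nonCenters (join k ts ls))               ∎
    where open ≤-Reasoning

  stable-card-< : ∀ T → IsTreeOfStars T → ∀ S → IsStable T S →
                  ∀ v → S v ≢ nonCenters T v → card T S < card T (nonCenters T)
  stable-card-< single _ S _ tt S≢ with S tt
  ... | true  = ⊥-elim (S≢ refl)
  ... | false = s≤s z≤n
  stable-card-< (join k ts ls) H S stable v S≢ with S (inj₁ tt) ≟ᵇ true
  ... | yes w∈ = root∈-card-< H S stable w∈
  stable-card-< (join k ts ls) H S stable (inj₁ tt) S≢ | no w∉ = ⊥-elim (S≢ (¬-not w∉))
  stable-card-< (join k ts ls) H@(_ , trees , _) S stable (inj₂ (i , u)) S≢ | no w∉ = begin-strict
    card (join k ts ls) S                                         ≡⟨ card-join k ts ls S (¬-not w∉) ⟩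
    sum (map (λ i → card (ts i) (λ v → S (inj₂ (i , v)))) (allFin k))
      <⟨ sum-map-mono-< (λ j → stable-card-≤ (ts j) (trees j) _ (restrict-stable stable j)) (∈-allFin i)
           (stable-card-< (ts i) (trees i) _ (restrict-stable stable i) u S≢) ⟩
    sum (map (λ i → card (ts i) (nonCenters (ts i))) (allFin k))  ≡⟨ card-join k ts ls (nonCenters _) refl ⟨
    card (join k ts ls) (nonCenters (join k ts ls))               ∎
    where open ≤-Reasoning

  -- S misses every attachment leaf ls i, a non-center, so it is strictly
  -- smaller than the non-centers on each of the k ≥ 2 components.
  root∈-card-< : ∀ {k ts ls} → IsTreeOfStars (join k ts ls) → ∀ S → IsStable (join k ts ls) S →
                 S (inj₁ tt) ≡ true → card (join k ts ls) S < card (join k ts ls) (nonCenters (join k ts ls))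
  root∈-card-< {k} {ts} {ls} (k≥2 , trees , leaves) S stable w∈ = begin-strict
    card (join k ts ls) S                            ≡⟨ card-join k ts ls S w∈ ⟩
    1 + Σparts                                       <⟨ +-monoˡ-≤ Σparts k≥2 ⟩
    k + Σparts                                       ≡⟨ cong (_+ Σparts) (length-tabulate id) ⟨
    length (allFin k) + Σparts                       ≤⟨ length+sum-map-≤ part<best (allFin k) ⟩
    sum (map (λ i → card (ts i) (nonCenters (ts i))) (allFin k)) ≡⟨ card-join k ts ls (nonCenters _) refl ⟨
    card (join k ts ls) (nonCenters (join k ts ls))  ∎
    where
    open ≤-Reasoning
    Σparts = sum (map (λ i → card (ts i) (λ v → S (inj₂ (i , v)))) (allFin k))
    part<best : ∀ i → card (ts i) (λ v → S (inj₂ (i , v))) < card (ts i) (nonCenters (ts i))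
    part<best i = stable-card-< (ts i) (trees i) _ (restrict-stable stable i) (ls i) λ l∈ →
      stable _ _ w∈ (trans l∈ (leaf-nonCenters (ts i) (trees i) (leaves i))) refl

maximum-stable-unique : ∀ T → IsTreeOfStars T → ∀ {S} → IsMaximumStable T S →
                        ∀ v → S v ≡ nonCenters T v
maximum-stable-unique T H {S} (stable , maximum) v with S v ≟ᵇ nonCenters T v
... | yes S≡ = S≡
... | no  S≢ = ⊥-elim (<⇒≱ (stable-card-< T H S stable v S≢)
                          (maximum (nonCenters T) (nonCenters-stable T H)))

lemma2 : (T : TS) → IsTreeOfStars T →
         (∃ λ S → IsNonCenterSet T S × IsMaximumStable T S) ×
         (∀ S → IsMaximumStable T S → IsNonCenterSet T S)
lemma2 T H = (nonCenters T , nonCenters-correct T H , nonCenters-maximum) , unique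
  where
  nonCenters-maximum : IsMaximumStable T (nonCenters T)
  nonCenters-maximum = nonCenters-stable T H , λ S stable → stable-card-≤ T H S stable
  unique : ∀ S → IsMaximumStable T S → IsNonCenterSet T S
  unique S maximum v rewrite maximum-stable-unique T H maximum v = nonCenters-correct T H v
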